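{- For every graph $G=(V,E)$ there exists an optimal solution $(M,y,c)$ of MFASP such that $c$ and $y$ are half-integral, i.e. $c\in\frac12\mathbb{Z}^E$ and $y\in\frac12\mathbb{Z}^V$.
   Context: All graphs are finite, undirected and simple, with unit edge weights. For $w\in\mathbb{R}^E_{\ge 0}$, a fractional $w$-vertex cover is $y\in\mathbb{R}^V_{\ge 0}$ with $y_u+y_v\ge w_{uv}$ for all $\{u,v\}\in E$. A feasible solution of MFASP is a triple $(M,y,c)$ where $c\in\mathbb{R}^E_{\ge 0}$, $M$ is a matching, $y$ is a fractional $(\mathbb{1}+c)$-vertex cover, and $\sum_{e\in M}(1+c_e)=\sum_{v\in V}y_v$; it is optimal if $\sum_{e}c_e$ is minimum among all feasible solutions.
   Formalization: The vectors c and y, both of the solution and of every competing feasible solution in the definition of optimality, take values in ℚ instead of ℝ. -}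

module Defs where

open import Data.Bool using (Bool; true; false; _∧_; if_then_else_; T)
open import Data.Nat as ℕ using (ℕ; _<ᵇ_)
open import Data.Integer using (ℤ)
open import Data.Fin using (Fin; toℕ)
open import Data.List using (List; map; concatMap; foldr; allFin)
open import Data.Product using (_×_; _,_; ∃; Σ)
open import Data.Rational using (ℚ; 0ℚ; 1ℚ; _+_; _≤_; _/_)
open import Relation.Binary.PropositionalEquality using (_≡_; _≢_)

record Graph (n : ℕ) : Set where
  field
    adj    : Fin n → Fin n → Bool
    sym    : ∀ i j → adj i j ≡ adj j i
    irrefl : ∀ i → adj i i ≡ false
open Graph public

-- Each edge {i,j} is represented once, by the ordered pair (i , j) with i < j.
isEdge : ∀ {n} → Graph n → Fin n → Fin n → Bool
isEdge G i j = (toℕ i <ᵇ toℕ j) ∧ adj G i j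

Edge : ∀ {n} → Graph n → Fin n → Fin n → Set
Edge G i j = T (isEdge G i j)

pairs : (n : ℕ) → List (Fin n × Fin n)
pairs n = concatMap (λ i → map (λ j → (i , j)) (allFin n)) (allFin n)

sumℚ : List ℚ → ℚ
sumℚ = foldr _+_ 0ℚ

sumV : ∀ {n} → (Fin n → ℚ) → ℚ
sumV {n} f = sumℚ (map f (allFin n))

sumE : ∀ {n} → Graph n → (Fin n → Fin n → Bool) → (Fin n → Fin n → ℚ) → ℚ
sumE {n} G P f =
  sumℚ (map (λ { (i , j) → if isEdge G i j ∧ P i j then f i j else 0ℚ }) (pairs n))

-- Edge weights c : indexed by pairs, only values c i j with Edge G i j matter.
-- A matching: a set of edges (boolean predicate on pairs) that pairwise share no vertex.
IsMatching : ∀ {n} → Graph n → (Fin n → Fin n → Bool) → Set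
IsMatching G M =
  (∀ i j → T (M i j) → Edge G i j) ×
  (∀ i j k l → T (M i j) → T (M k l) → (i , j) ≢ (k , l) →
     (i ≢ k) × (i ≢ l) × (j ≢ k) × (j ≢ l))

IsFracCover : ∀ {n} → Graph n → (Fin n → Fin n → ℚ) → (Fin n → ℚ) → Set
IsFracCover G c y =
  (∀ v → 0ℚ ≤ y v) × (∀ i j → Edge G i j → 1ℚ + c i j ≤ y i + y j)

MFASPFeasible : ∀ {n} → Graph n → (Fin n → Fin n → Bool) → (Fin n → ℚ) → (Fin n → Fin n → ℚ) → Set
MFASPFeasible G M y c =
  (∀ i j → Edge G i j → 0ℚ ≤ c i j) ×
  IsMatching G M ×
  IsFracCover G c y ×
  (sumE G M (λ i j → 1ℚ + c i j) ≡ sumV y)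

cost : ∀ {n} → Graph n → (Fin n → Fin n → ℚ) → ℚ
cost G c = sumE G (λ _ _ → true) c

MFASPOptimal : ∀ {n} → Graph n → (Fin n → Fin n → Bool) → (Fin n → ℚ) → (Fin n → Fin n → ℚ) → Set
MFASPOptimal G M y c =
  MFASPFeasible G M y c ×
  (∀ M' y' c' → MFASPFeasible G M' y' c' → cost G c ≤ cost G c')

HalfIntegral : ℚ → Set
HalfIntegral q = ∃ λ (k : ℤ) → q ≡ k / 2

{-# OPTIONS --safe #-}
module Submission where

-- Fix a feasible (M, y, c). Summing the covering constraints over the matching shows that y
-- vanishes off the vertices covered by M, and y is a fractional vertex cover. Write y = Y/2K
-- with Y natural and round at a threshold m < K: z_v = ½([m < Y_v] + [2K ≤ Y_v + m]). Then
-- y_u + y_v ≥ 1 implies z_u + z_v ≥ 1, z vanishes where y does, and on average over m the sum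
-- does not grow, so Σ z ≤ Σ y for some m. Taking c_e = z_u + z_v - 1 on M and 0 elsewhere gives
-- a feasible solution (M, z, c') of cost at most that of (M, y, c). Hence an optimum can be
-- sought among the finitely many pairs (M, 2z) with 2z ∈ {0,1,2}^V; a feasible one exists
-- (a greedy maximal matching with z = 1 on its vertices), so a cheapest one is optimal.

open import Defs hiding (sym)
open import Data.Nat using (ℕ)
open import Data.Product using (_×_; ∃)

module Threshold where

  open import Data.Nat
  open import Data.Nat.Properties
  open import Data.Bool using (Bool; true; false; if_then_else_; T)
  open import Data.Fin using (Fin; zero; suc; toℕ)
  open import Data.Fin.Properties using (toℕ<n)
  open import Data.List using (allFin)
  open import Data.List.Extrema ≤-totalOrder using (argmin; f[argmin]≤f[xs])
  open import Data.List.Relation.Unary.All as All using (All)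
  open import Data.List.Membership.Propositional.Properties using (∈-allFin)
  open import Data.Product using (_×_; ∃; _,_; proj₁; proj₂)
  open import Data.Unit using (tt)
  open import Function using (_∘_)
  open import Relation.Binary.PropositionalEquality hiding ([_])
  open import Relation.Nullary using (¬_; yes; no; contradiction)
  open import Algebra.Properties.Semiring.Sum +-*-semiring using (sum; sum-syntax; sum-cong-≗; ∑-comm; ∑-distrib-+)

  [_] : Bool → ℕ
  [ b ] = if b then 1 else 0

  sum-mono-≤ : ∀ {n} {f g : Fin n → ℕ} → (∀ i → f i ≤ g i) → sum f ≤ sum g
  sum-mono-≤ {zero}  f≤g = z≤n
  sum-mono-≤ {suc n} f≤g = +-mono-≤ (f≤g zero) (sum-mono-≤ (f≤g ∘ suc))

  sum-const : ∀ K c → ∑[ _ < K ] c ≡ K * c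
  sum-const zero    c = refl
  sum-const (suc K) c = cong (c +_) (sum-const K c)

  ∃-≤-average : ∀ {K} (F : Fin (suc K) → ℕ) → ∃ λ m → suc K * F m ≤ sum F
  ∃-≤-average {K} F = m , (begin
    suc K * F m          ≡⟨ sum-const (suc K) (F m) ⟨
    ∑[ _ < suc K ] F m   ≤⟨ sum-mono-≤ (λ i → All.lookup (f[argmin]≤f[xs] {f = F} zero (allFin (suc K))) (∈-allFin i)) ⟩
    sum F                ∎)
    where
    open ≤-Reasoning
    m : Fin (suc K)
    m = argmin F zero (allFin (suc K))

  count-below : ∀ K a → ∑[ m < K ] [ toℕ m <ᵇ a ] ≡ K ⊓ a
  count-below zero    a       = refl
  count-below (suc K) zero    = trans (count-below K 0) (⊓-zeroʳ K)
  count-below (suc K) (suc a) = cong suc (count-below K a)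

  count-above : ∀ K t a → ∑[ m < K ] [ t ≤ᵇ a + toℕ m ] ≡ K ∸ (t ∸ a)
  count-above zero    t a = sym (0∸n≡0 (t ∸ a))
  count-above (suc K) t a = begin
    [ t ≤ᵇ a + 0 ] + ∑[ m < K ] [ t ≤ᵇ a + suc (toℕ m) ]  ≡⟨ cong₂ _+_ (cong (λ x → [ t ≤ᵇ x ]) (+-identityʳ a))
                                                              (sum-cong-≗ {K} λ m → cong (λ x → [ t ≤ᵇ x ]) (+-suc a (toℕ m))) ⟩
    [ t ≤ᵇ a ] + ∑[ m < K ] [ t ≤ᵇ suc a + toℕ m ]        ≡⟨ cong ([ t ≤ᵇ a ] +_) (count-above K t (suc a)) ⟩
    [ t ≤ᵇ a ] + (K ∸ (t ∸ suc a))                         ≡⟨ step t a ⟩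
    suc K ∸ (t ∸ a)                                        ∎
    where
    open ≡-Reasoning
    step : ∀ t a → [ t ≤ᵇ a ] + (K ∸ (t ∸ suc a)) ≡ suc K ∸ (t ∸ a)
    step zero             zero    = refl
    step zero             (suc a) = refl
    step (suc t)          zero    = refl
    step (suc zero)       (suc a) = cong (suc K ∸_) (sym (0∸n≡0 a))
    step (suc (suc t))    (suc a) = step (suc t) a

  ⊓-+-∸-≤ : ∀ K a → K ⊓ a + (K ∸ ((K + K) ∸ a)) ≤ a
  ⊓-+-∸-≤ K a = begin
    K ⊓ a + (K ∸ ((K + K) ∸ a))   ≤⟨ +-monoʳ-≤ (K ⊓ a) (m≤n+o⇒m∸n≤o K ((K + K) ∸ a) K≤) ⟩
    K ⊓ a + (a ∸ K)               ≡⟨ m⊓n+n∸m≡n K a ⟩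
    a                             ∎
    where
    open ≤-Reasoning
    K≤ : K ≤ (K + K) ∸ a + (a ∸ K)
    K≤ = +-cancelˡ-≤ K K _ (begin
      K + K                           ≤⟨ m≤n+m∸n (K + K) a ⟩
      a + ((K + K) ∸ a)               ≤⟨ +-monoˡ-≤ ((K + K) ∸ a) (m≤n+m∸n a K) ⟩
      K + (a ∸ K) + ((K + K) ∸ a)     ≡⟨ +-assoc K (a ∸ K) _ ⟩
      K + ((a ∸ K) + ((K + K) ∸ a))   ≡⟨ cong (K +_) (+-comm (a ∸ K) _) ⟩
      K + ((K + K) ∸ a + (a ∸ K))     ∎)

  []-true : ∀ {b} → T b → [ b ] ≡ 1
  []-true {true} _ = refl

  []-false : ∀ {b} → ¬ T b → [ b ] ≡ 0
  []-false {true}  ¬t = contradiction tt ¬t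
  []-false {false} _  = refl

  []-≤1 : ∀ b → [ b ] ≤ 1
  []-≤1 true  = ≤-refl
  []-≤1 false = z≤n

  -- roundAt K m (2K y) = 2z, where z rounds y at the thresholds θ = m/2K and 1 - θ.
  roundAt : ℕ → ℕ → ℕ → ℕ
  roundAt K m a = [ m <ᵇ a ] + [ K + K ≤ᵇ a + m ]

  roundAt-≤2 : ∀ K m a → roundAt K m a ≤ 2
  roundAt-≤2 K m a = +-mono-≤ ([]-≤1 (m <ᵇ a)) ([]-≤1 (K + K ≤ᵇ a + m))

  roundAt-zero : ∀ {K m} → m < K → roundAt K m 0 ≡ 0
  roundAt-zero {K} {m} m<K = []-false λ t → <⇒≱ (<-≤-trans m<K (m≤m+n K K)) (≤ᵇ⇒≤ (K + K) m t)

  sum-roundAt-≤ : ∀ K a → ∑[ m < K ] roundAt K (toℕ m) a ≤ a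
  sum-roundAt-≤ K a = begin
    ∑[ m < K ] roundAt K (toℕ m) a                                    ≡⟨ ∑-distrib-+ {K} (λ m → [ toℕ m <ᵇ a ]) (λ m → [ K + K ≤ᵇ a + toℕ m ]) ⟩
    ∑[ m < K ] [ toℕ m <ᵇ a ] + ∑[ m < K ] [ K + K ≤ᵇ a + toℕ m ]      ≡⟨ cong₂ _+_ (count-below K a) (count-above K (K + K) a) ⟩
    K ⊓ a + (K ∸ ((K + K) ∸ a))                                       ≤⟨ ⊓-+-∸-≤ K a ⟩
    a                                                                 ∎
    where open ≤-Reasoning

  roundAt-saturated : ∀ {K m a b} → a ≤ m → m < K → K + K ≤ a + b → roundAt K m b ≡ 2
  roundAt-saturated {K} {m} {a} {b} a≤m m<K cover = cong₂ _+_ ([]-true (<⇒<ᵇ m<b)) ([]-true (≤⇒≤ᵇ K+K≤b+m))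
    where
    K+K≤b+m : K + K ≤ b + m
    K+K≤b+m = ≤-trans cover (≤-trans (+-monoˡ-≤ b a≤m) (≤-reflexive (+-comm m b)))
    m<b : m < b
    m<b = +-cancelʳ-< m m b (<-≤-trans (+-mono-< m<K m<K) K+K≤b+m)

  roundAt-cover : ∀ {K m a b} → m < K → K + K ≤ a + b → 2 ≤ roundAt K m a + roundAt K m b
  roundAt-cover {K} {m} {a} {b} m<K cover with m <? a | m <? b
  ... | yes m<a | yes m<b = +-mono-≤ (positive m<a) (positive m<b)
    where
    positive : ∀ {c} → m < c → 1 ≤ roundAt K m c
    positive {c} m<c = ≤-trans (≤-reflexive (sym ([]-true (<⇒<ᵇ m<c)))) (m≤m+n [ m <ᵇ c ] [ K + K ≤ᵇ c + m ])
  ... | no m≮a  | _       = begin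
    2                             ≡⟨ roundAt-saturated (≮⇒≥ m≮a) m<K cover ⟨
    roundAt K m b                 ≤⟨ m≤n+m (roundAt K m b) (roundAt K m a) ⟩
    roundAt K m a + roundAt K m b ∎
    where open ≤-Reasoning
  ... | yes _   | no m≮b  = begin
    2                             ≡⟨ roundAt-saturated (≮⇒≥ m≮b) m<K (≤-trans cover (≤-reflexive (+-comm a b))) ⟨
    roundAt K m a                 ≤⟨ m≤m+n (roundAt K m a) (roundAt K m b) ⟩
    roundAt K m a + roundAt K m b ∎
    where open ≤-Reasoning

  ∃-threshold : ∀ K {n} (Y : Fin n → ℕ) →
    ∃ λ m → m < suc K × suc K * ∑[ v < n ] roundAt (suc K) m (Y v) ≤ ∑[ v < n ] Y v
  ∃-threshold K {n} Y = toℕ m , toℕ<n m , (begin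
    suc K * F m                                                ≤⟨ proj₂ (∃-≤-average F) ⟩
    ∑[ m < suc K ] ∑[ v < n ] roundAt (suc K) (toℕ m) (Y v)    ≡⟨ ∑-comm {suc K} {n} (λ m v → roundAt (suc K) (toℕ m) (Y v)) ⟩
    ∑[ v < n ] ∑[ m < suc K ] roundAt (suc K) (toℕ m) (Y v)    ≤⟨ sum-mono-≤ (λ v → sum-roundAt-≤ (suc K) (Y v)) ⟩
    ∑[ v < n ] Y v                                             ∎)
    where
    open ≤-Reasoning
    F : Fin (suc K) → ℕ
    F m = ∑[ v < n ] roundAt (suc K) (toℕ m) (Y v)
    m : Fin (suc K)
    m = proj₁ (∃-≤-average F)

open import Algebra.Bundles using (CommutativeRing)
import Algebra.Properties.Semiring.Sum
open import Data.Bool using (Bool; true; false; if_then_else_; _∧_; _∨_; T)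
open import Data.Bool.Properties using (T-∧; T-∨)
open import Data.Empty using (⊥; ⊥-elim)
open import Data.Fin using (Fin; zero; suc; toℕ)
import Data.Fin.Properties as Fin
open import Data.Integer as ℤ using (+_)
import Data.Integer.Properties as ℤ
open import Data.Integer.Solver using (module +-*-Solver)
open import Data.List using (List; []; _∷_; _++_; map; concatMap; foldl; allFin; tabulate; upTo; filter; cartesianProduct)
import Data.List.Extrema
import Data.List.Properties as List
open import Data.List.Membership.Propositional using (_∈_)
open import Data.List.Membership.Propositional.Properties using (∈-concatMap⁺; ∈-map⁺; ∈-allFin; ∈-upTo⁺)
open import Data.List.Relation.Unary.Any as Any using (Any; here; there)
import Data.List.Relation.Unary.Any.Properties as Any
open import Data.List.Relation.Unary.All.Properties using (all-filter)
open import Data.Nat as ℕ using (zero; suc; s≤s)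
import Data.Nat.Properties as ℕ
open import Data.Product using (_,_; proj₁; proj₂)
import Data.Product as Product
open import Data.Product.Properties using (≡-dec)
open import Data.Rational
open import Data.Rational.Properties
import Data.Rational.Unnormalised.Base as ℚᵘ
import Data.Rational.Unnormalised.Properties as ℚᵘ
open import Data.Sum using (_⊎_; inj₁; inj₂; [_,_]′)
import Data.Sum as Sum
open import Data.Unit using (tt)
import Data.Vec.Functional as Vector
open import Function using (_∘_; id)
open import Function.Bundles using (Equivalence)
open import Relation.Binary using (DecTotalOrder)
open import Relation.Binary.PropositionalEquality
open import Relation.Nullary using (¬_; Dec; yes; no; does; contradiction)
open import Relation.Nullary.Decidable using (T?; _⊎-dec_; _×-dec_; _→-dec_; ¬?; dec-true; dec-false)
open import Relation.Unary using (Decidable)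

open import Algebra.Properties.Semiring.Sum (CommutativeRing.semiring +-*-commutativeRing)
  using (sum; sum-syntax; sum-cong-≗; sum-replicate-zero; ∑-comm; ∑-distrib-+; *-distribʳ-sum)
module ℕΣ = Algebra.Properties.Semiring.Sum ℕ.+-*-semiring
open Data.List.Extrema (DecTotalOrder.totalOrder ≤-decTotalOrder) using (argmin; argmin-all; f[argmin]≤v⁺)
open Threshold using (roundAt; roundAt-≤2; roundAt-zero; roundAt-cover; ∃-threshold)

-- Half-integers and the embedding of ℕ into ℚ

half : ℕ → ℚ
half a = + a / 2

fromℕ : ℕ → ℚ
fromℕ a = + a / 1

private
  toℚᵘ-/ : ∀ a d → toℚᵘ (+ a / suc d) ℚᵘ.≃ ℚᵘ.mkℚᵘ (+ a) d
  toℚᵘ-/ a d = toℚᵘ-fromℚᵘ (ℚᵘ.mkℚᵘ (+ a) d)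

half-homo-+ : ∀ a b → half (a ℕ.+ b) ≡ half a + half b
half-homo-+ a b = toℚᵘ-injective (begin-equality
  toℚᵘ (half (a ℕ.+ b))                   ≃⟨ toℚᵘ-/ (a ℕ.+ b) 1 ⟩
  ℚᵘ.mkℚᵘ (+ (a ℕ.+ b)) 1                 ≃⟨ ℚᵘ.*≡* (trans (cong (ℤ._* + 4) (ℤ.pos-+ a b)) (double (+ a) (+ b))) ⟩
  ℚᵘ.mkℚᵘ (+ a) 1 ℚᵘ.+ ℚᵘ.mkℚᵘ (+ b) 1  ≃⟨ ℚᵘ.+-cong (toℚᵘ-/ a 1) (toℚᵘ-/ b 1) ⟨
  toℚᵘ (half a) ℚᵘ.+ toℚᵘ (half b)        ≃⟨ toℚᵘ-homo-+ (half a) (half b) ⟨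
  toℚᵘ (half a + half b)                  ∎)
  where
  open ℚᵘ.≤-Reasoning
  open +-*-Solver
  double : ∀ x y → (x ℤ.+ y) ℤ.* + 4 ≡ (x ℤ.* + 2 ℤ.+ y ℤ.* + 2) ℤ.* + 2
  double = solve 2 (λ x y → (x :+ y) :* con (+ 4) := (x :* con (+ 2) :+ y :* con (+ 2)) :* con (+ 2)) refl

half-mono-≤ : ∀ {a b} → a ℕ.≤ b → half a ≤ half b
half-mono-≤ {a} {b} a≤b = toℚᵘ-cancel-≤ (begin
  toℚᵘ (half a)      ≃⟨ toℚᵘ-/ a 1 ⟩
  ℚᵘ.mkℚᵘ (+ a) 1    ≤⟨ ℚᵘ.*≤* (ℤ.*-monoʳ-≤-nonNeg (+ 2) (ℤ.+≤+ a≤b)) ⟩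
  ℚᵘ.mkℚᵘ (+ b) 1    ≃⟨ toℚᵘ-/ b 1 ⟨
  toℚᵘ (half b)      ∎)
  where open ℚᵘ.≤-Reasoning

half-nonNeg : ∀ a → 0ℚ ≤ half a
half-nonNeg a = half-mono-≤ {0} {a} ℕ.z≤n

1+half[a∸2]≡half[a] : ∀ {a} → 2 ℕ.≤ a → 1ℚ + half (a ℕ.∸ 2) ≡ half a
1+half[a∸2]≡half[a] {a} 2≤a = trans (sym (half-homo-+ 2 (a ℕ.∸ 2))) (cong half (ℕ.m+[n∸m]≡n 2≤a))

half-cancel-≤ : ∀ {a b} → half a ≤ half b → a ℕ.≤ b
half-cancel-≤ {a} {b} ha≤hb with ℚᵘ.≤-respˡ-≃ (toℚᵘ-/ a 1) (ℚᵘ.≤-respʳ-≃ (toℚᵘ-/ b 1) (toℚᵘ-mono-≤ ha≤hb))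
... | ℚᵘ.*≤* 2a≤2b = ℤ.drop‿+≤+ (ℤ.*-cancelʳ-≤-pos (+ a) (+ b) (+ 2) 2a≤2b)

half-*-fromℕ : ∀ a k → half a * fromℕ k ≡ half (a ℕ.* k)
half-*-fromℕ a k = toℚᵘ-injective (begin-equality
  toℚᵘ (half a * fromℕ k)                     ≃⟨ toℚᵘ-homo-* (half a) (fromℕ k) ⟩
  toℚᵘ (half a) ℚᵘ.* toℚᵘ (fromℕ k)           ≃⟨ ℚᵘ.*-cong (toℚᵘ-/ a 1) (toℚᵘ-/ k 0) ⟩
  ℚᵘ.mkℚᵘ (+ a ℤ.* + k) 1                      ≡⟨ cong (λ x → ℚᵘ.mkℚᵘ x 1) (ℤ.pos-* a k) ⟨
  ℚᵘ.mkℚᵘ (+ (a ℕ.* k)) 1                      ≃⟨ toℚᵘ-/ (a ℕ.* k) 1 ⟨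
  toℚᵘ (half (a ℕ.* k))                       ∎)
  where open ℚᵘ.≤-Reasoning

fromℕ-homo-* : ∀ a b → fromℕ (a ℕ.* b) ≡ fromℕ a * fromℕ b
fromℕ-homo-* a b = toℚᵘ-injective (begin-equality
  toℚᵘ (fromℕ (a ℕ.* b))                      ≃⟨ toℚᵘ-/ (a ℕ.* b) 0 ⟩
  ℚᵘ.mkℚᵘ (+ (a ℕ.* b)) 0                      ≡⟨ cong (λ x → ℚᵘ.mkℚᵘ x 0) (ℤ.pos-* a b) ⟩
  ℚᵘ.mkℚᵘ (+ a ℤ.* + b) 0                      ≃⟨ ℚᵘ.*-cong (toℚᵘ-/ a 0) (toℚᵘ-/ b 0) ⟨
  toℚᵘ (fromℕ a) ℚᵘ.* toℚᵘ (fromℕ b)          ≃⟨ toℚᵘ-homo-* (fromℕ a) (fromℕ b) ⟨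
  toℚᵘ (fromℕ a * fromℕ b)                    ∎)
  where open ℚᵘ.≤-Reasoning

fromℕ≡half-double : ∀ a → fromℕ a ≡ half (2 ℕ.* a)
fromℕ≡half-double a = trans (sym (*-identityˡ (fromℕ a))) (half-*-fromℕ 2 a)

fromℕ-suc-positive : ∀ k → Positive (fromℕ (suc k))
fromℕ-suc-positive k =
  positive (toℚᵘ-cancel-< (ℚᵘ.<-respʳ-≃ (ℚᵘ.≃-sym (toℚᵘ-/ (suc k) 0)) (ℚᵘ.*<* (ℤ.+<+ (ℕ.s≤s ℕ.z≤n)))))

numerator-nonNeg : ∀ p → 0ℚ ≤ p → ∃ λ a → ↥ p ≡ + a
numerator-nonNeg (mkℚ (+ a) _ _) _ = a , refl
numerator-nonNeg (mkℚ ℤ.-[1+ _ ] _ _) (*≤* ())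

*-denominator : ∀ p {a} → ↥ p ≡ + a → p * fromℕ (↧ₙ p) ≡ fromℕ a
*-denominator p@(mkℚ _ d _) {a} refl = toℚᵘ-injective (begin-equality
  toℚᵘ (p * fromℕ (suc d))                    ≃⟨ toℚᵘ-homo-* p (fromℕ (suc d)) ⟩
  ℚᵘ.mkℚᵘ (+ a) d ℚᵘ.* toℚᵘ (fromℕ (suc d))   ≃⟨ ℚᵘ.*-congˡ {ℚᵘ.mkℚᵘ (+ a) d} (toℚᵘ-/ (suc d) 0) ⟩
  ℚᵘ.mkℚᵘ (+ a ℤ.* + suc d) (d ℕ.* 1)         ≃⟨ ℚᵘ.*≡* cancel ⟩
  ℚᵘ.mkℚᵘ (+ a) 0                              ≃⟨ toℚᵘ-/ a 0 ⟨
  toℚᵘ (fromℕ a)                              ∎)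
  where
  open ℚᵘ.≤-Reasoning
  cancel : (+ a ℤ.* + suc d) ℤ.* + 1 ≡ + a ℤ.* + suc (d ℕ.* 1)
  cancel = trans (ℤ.*-identityʳ _) (cong (λ x → + a ℤ.* + suc x) (sym (ℕ.*-identityʳ d)))

-- Sums over vertices and over edges

sum-mono-≤ : ∀ {n} {f g : Fin n → ℚ} → (∀ i → f i ≤ g i) → sum f ≤ sum g
sum-mono-≤ {zero}  f≤g = ≤-refl
sum-mono-≤ {suc n} f≤g = +-mono-≤ (f≤g zero) (sum-mono-≤ (f≤g ∘ suc))

sumℚ-++ : ∀ xs ys → sumℚ (xs ++ ys) ≡ sumℚ xs + sumℚ ys
sumℚ-++ []       ys = sym (+-identityˡ (sumℚ ys))
sumℚ-++ (x ∷ xs) ys = trans (cong (_+_ x) (sumℚ-++ xs ys)) (sym (+-assoc x (sumℚ xs) (sumℚ ys)))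

sumℚ-map-concatMap : ∀ {A B : Set} (g : B → ℚ) (k : A → List B) xs →
  sumℚ (map g (concatMap k xs)) ≡ sumℚ (map (λ x → sumℚ (map g (k x))) xs)
sumℚ-map-concatMap g k []       = refl
sumℚ-map-concatMap g k (x ∷ xs) = begin
  sumℚ (map g (k x ++ concatMap k xs))              ≡⟨ cong sumℚ (List.map-++ g (k x) (concatMap k xs)) ⟩
  sumℚ (map g (k x) ++ map g (concatMap k xs))      ≡⟨ sumℚ-++ (map g (k x)) _ ⟩
  sumℚ (map g (k x)) + sumℚ (map g (concatMap k xs)) ≡⟨ cong (_+_ (sumℚ (map g (k x)))) (sumℚ-map-concatMap g k xs) ⟩
  sumℚ (map g (k x)) + sumℚ (map (λ x → sumℚ (map g (k x))) xs) ∎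
  where open ≡-Reasoning

sumV≡sum : ∀ {n} (f : Fin n → ℚ) → sumV f ≡ sum f
sumV≡sum {n} f = trans (cong sumℚ (List.map-tabulate id f)) (sumℚ-tabulate n f)
  where
  sumℚ-tabulate : ∀ n (f : Fin n → ℚ) → sumℚ (tabulate f) ≡ sum f
  sumℚ-tabulate zero    f = refl
  sumℚ-tabulate (suc n) f = cong (_+_ (f zero)) (sumℚ-tabulate n (f ∘ suc))

isEdgeIn : ∀ {n} → Graph n → (Fin n → Fin n → Bool) → Fin n → Fin n → Bool
isEdgeIn G P i j = isEdge G i j ∧ P i j

module _ {n} (G : Graph n) (P : Fin n → Fin n → Bool) {i j : Fin n} where

  isEdgeIn⁻ : T (isEdgeIn G P i j) → Edge G i j × T (P i j)
  isEdgeIn⁻ = Equivalence.to T-∧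

  isEdgeIn⁺ : Edge G i j → T (P i j) → T (isEdgeIn G P i j)
  isEdgeIn⁺ e p = Equivalence.from T-∧ (e , p)

summandE : ∀ {n} → Graph n → (Fin n → Fin n → Bool) → (Fin n → Fin n → ℚ) → Fin n → Fin n → ℚ
summandE G P f i j = if isEdgeIn G P i j then f i j else 0ℚ

sumE≡sum² : ∀ {n} (G : Graph n) P f → sumE G P f ≡ ∑[ i < n ] ∑[ j < n ] summandE G P f i j
sumE≡sum² {n} G P f = begin
  sumE G P f                                             ≡⟨ sumℚ-map-concatMap summand row (allFin n) ⟩
  sumV (λ i → sumℚ (map summand (row i)))                ≡⟨ sumV≡sum (λ i → sumℚ (map summand (row i))) ⟩
  ∑[ i < n ] sumℚ (map summand (row i))                  ≡⟨ sum-cong-≗ (λ i → trans (cong sumℚ (sym (List.map-∘ (allFin n)))) (sumV≡sum (summandE G P f i))) ⟩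
  ∑[ i < n ] ∑[ j < n ] summandE G P f i j               ∎
  where
  open ≡-Reasoning
  summand : Fin n × Fin n → ℚ
  summand (i , j) = summandE G P f i j
  row : Fin n → List (Fin n × Fin n)
  row i = map (i ,_) (allFin n)

sumE-cong : ∀ {n} (G : Graph n) {P Q f g} → (∀ i j → summandE G P f i j ≡ summandE G Q g i j) →
  sumE G P f ≡ sumE G Q g
sumE-cong G {P} {Q} {f} {g} eq =
  trans (sumE≡sum² G P f) (trans (sum-cong-≗ λ i → sum-cong-≗ (eq i)) (sym (sumE≡sum² G Q g)))

sumE-mono-≤ : ∀ {n} (G : Graph n) {P Q f g} → (∀ i j → summandE G P f i j ≤ summandE G Q g i j) →
  sumE G P f ≤ sumE G Q g
sumE-mono-≤ {n} G {P} {Q} {f} {g} le = begin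
  sumE G P f                                ≡⟨ sumE≡sum² G P f ⟩
  ∑[ i < n ] ∑[ j < n ] summandE G P f i j  ≤⟨ sum-mono-≤ (λ i → sum-mono-≤ (le i)) ⟩
  ∑[ i < n ] ∑[ j < n ] summandE G Q g i j  ≡⟨ sumE≡sum² G Q g ⟨
  sumE G Q g                                ∎
  where open ≤-Reasoning

if-distrib-+ : ∀ b (x y : ℚ) → (if b then x + y else 0ℚ) ≡ (if b then x else 0ℚ) + (if b then y else 0ℚ)
if-distrib-+ true  x y = refl
if-distrib-+ false x y = refl

sumE-+ : ∀ {n} (G : Graph n) P (f g : Fin n → Fin n → ℚ) →
  sumE G P (λ i j → f i j + g i j) ≡ sumE G P f + sumE G P g
sumE-+ {n} G P f g = begin
  sumE G P (λ i j → f i j + g i j)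
    ≡⟨ sumE≡sum² G P _ ⟩
  ∑[ i < n ] ∑[ j < n ] summandE G P (λ i j → f i j + g i j) i j
    ≡⟨ sum-cong-≗ (λ i → trans (sum-cong-≗ (λ j → if-distrib-+ (isEdgeIn G P i j) (f i j) (g i j)))
                               (∑-distrib-+ (summandE G P f i) (summandE G P g i))) ⟩
  ∑[ i < n ] (∑[ j < n ] summandE G P f i j + ∑[ j < n ] summandE G P g i j)
    ≡⟨ ∑-distrib-+ (λ i → ∑[ j < n ] summandE G P f i j) (λ i → ∑[ j < n ] summandE G P g i j) ⟩
  ∑[ i < n ] ∑[ j < n ] summandE G P f i j + ∑[ i < n ] ∑[ j < n ] summandE G P g i j
    ≡⟨ cong₂ _+_ (sumE≡sum² G P f) (sumE≡sum² G P g) ⟨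
  sumE G P f + sumE G P g
    ∎
  where open ≡-Reasoning

sum-mono-< : ∀ {n} {f g : Fin n → ℚ} → (∀ i → f i ≤ g i) → ∀ i → f i < g i → sum f < sum g
sum-mono-< {suc n} f≤g zero    fi<gi = +-mono-<-≤ fi<gi (sum-mono-≤ (f≤g ∘ suc))
sum-mono-< {suc n} f≤g (suc i) fi<gi = +-mono-≤-< (f≤g zero) (sum-mono-< (f≤g ∘ suc) i fi<gi)

sum-squeeze : ∀ {n} {f g : Fin n → ℚ} → (∀ i → f i ≤ g i) → sum g ≤ sum f → ∀ i → g i ≤ f i
sum-squeeze f≤g Σg≤Σf i = ≮⇒≥ λ fi<gi → <-irrefl refl (<-≤-trans (sum-mono-< f≤g i fi<gi) Σg≤Σf)

+-cancelˡ-≤ : ∀ r {p q} → r + p ≤ r + q → p ≤ q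
+-cancelˡ-≤ r r+p≤r+q = ≮⇒≥ λ q<p → <-irrefl refl (<-≤-trans (+-mono-≤-< (≤-refl {r}) q<p) r+p≤r+q)

module _ {n} (G : Graph n) {P : Fin n → Fin n → Bool} {f g : Fin n → Fin n → ℚ} where

  sumE-cong-on : (∀ i j → T (isEdgeIn G P i j) → f i j ≡ g i j) → sumE G P f ≡ sumE G P g
  sumE-cong-on eq = sumE-cong G λ i j → on (isEdgeIn G P i j) (eq i j)
    where
    on : ∀ b {x y} → (T b → x ≡ y) → (if b then x else 0ℚ) ≡ (if b then y else 0ℚ)
    on true  x≡y = x≡y _
    on false _   = refl

  sumE-mono-on : (∀ i j → T (isEdgeIn G P i j) → f i j ≤ g i j) → sumE G P f ≤ sumE G P g
  sumE-mono-on le = sumE-mono-≤ G λ i j → on (isEdgeIn G P i j) (le i j)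
    where
    on : ∀ b {x y} → (T b → x ≤ y) → (if b then x else 0ℚ) ≤ (if b then y else 0ℚ)
    on true  x≤y = x≤y _
    on false _   = ≤-refl

module _ {n} (G : Graph n) (P : Fin n → Fin n → Bool) {f : Fin n → Fin n → ℚ} where

  cost≡sumE : (∀ i j → ¬ T (P i j) → f i j ≡ 0ℚ) → cost G f ≡ sumE G P f
  cost≡sumE vanish = sumE-cong G λ i j → restrict (isEdge G i j) (P i j) (vanish i j)
    where
    restrict : ∀ e b {x} → (¬ T b → x ≡ 0ℚ) → (if e ∧ true then x else 0ℚ) ≡ (if e ∧ b then x else 0ℚ)
    restrict false b     _      = refl
    restrict true  true  _      = refl
    restrict true  false vanish = vanish λ ()

  sumE≤cost : (∀ i j → Edge G i j → 0ℚ ≤ f i j) → sumE G P f ≤ cost G f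
  sumE≤cost nonNeg = sumE-mono-≤ G λ i j → extend (isEdge G i j) (P i j) (nonNeg i j)
    where
    extend : ∀ e b {x} → (T e → 0ℚ ≤ x) → (if e ∧ b then x else 0ℚ) ≤ (if e ∧ true then x else 0ℚ)
    extend false b     _      = ≤-refl
    extend true  true  _      = ≤-refl
    extend true  false nonNeg = nonNeg _

-- Matchings

Covered : ∀ {n} → Graph n → (Fin n → Fin n → Bool) → Fin n → Set
Covered G M v = (∃ λ w → T (isEdgeIn G M v w)) ⊎ (∃ λ u → T (isEdgeIn G M u v))

covered? : ∀ {n} (G : Graph n) M → Decidable (Covered G M)
covered? G M v = Fin.any? (λ w → T? (isEdgeIn G M v w)) ⊎-dec Fin.any? (λ u → T? (isEdgeIn G M u v))

sum-if-unique : ∀ {n} (P : Fin n → Bool) a → (∀ j k → T (P j) → T (P k) → j ≡ k) →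
  ∑[ j < n ] (if P j then a else 0ℚ) ≡ (if does (Fin.any? (T? ∘ P)) then a else 0ℚ)
sum-if-unique {zero}  P a unique = refl
sum-if-unique {suc n} P a unique with P zero in P0
... | true  = trans (cong (_+_ a) (trans (sum-cong-≗ absent) (sum-replicate-zero n))) (+-identityʳ a)
  where
  absent : ∀ j → (if P (suc j) then a else 0ℚ) ≡ 0ℚ
  absent j with P (suc j) in Pj
  ... | true  = contradiction (unique zero (suc j) (subst T (sym P0) tt) (subst T (sym Pj) tt)) λ ()
  ... | false = refl
... | false = trans (+-identityˡ _) (sum-if-unique (P ∘ suc) a (λ j k p q → Fin.suc-injective (unique (suc j) (suc k) p q)))

loopless : ∀ {n} (G : Graph n) v → ¬ Edge G v v
loopless G v e =
  ℕ.<-irrefl refl (ℕ.<ᵇ⇒< (toℕ v) (toℕ v) (proj₁ (Equivalence.to (T-∧ {toℕ v ℕ.<ᵇ toℕ v} {adj G v v}) e)))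

module _ {n} (G : Graph n) {M} (isM : IsMatching G M) where

  private
    inM : ∀ {i j} → T (isEdgeIn G M i j) → T (M i j)
    inM = proj₂ ∘ isEdgeIn⁻ G M

    disjoint : ∀ {i j k l} → T (isEdgeIn G M i j) → T (isEdgeIn G M k l) → (i , j) ≢ (k , l) →
      (i ≢ k) × (i ≢ l) × (j ≢ k) × (j ≢ l)
    disjoint p q = proj₂ isM _ _ _ _ (inM p) (inM q)

  matched-unique-out : ∀ {v j k} → T (isEdgeIn G M v j) → T (isEdgeIn G M v k) → j ≡ k
  matched-unique-out {j = j} {k} p q with j Fin.≟ k
  ... | yes j≡k = j≡k
  ... | no  j≢k = contradiction refl (proj₁ (disjoint p q (j≢k ∘ cong proj₂)))

  matched-unique-in : ∀ {v i k} → T (isEdgeIn G M i v) → T (isEdgeIn G M k v) → i ≡ k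
  matched-unique-in {i = i} {k} p q with i Fin.≟ k
  ... | yes i≡k = i≡k
  ... | no  i≢k = contradiction refl (proj₂ (proj₂ (proj₂ (disjoint p q (i≢k ∘ cong proj₁)))))

  matched-not-out-and-in : ∀ {v j u} → T (isEdgeIn G M v j) → T (isEdgeIn G M u v) → ⊥
  matched-not-out-and-in {v} {j} {u} p q with v Fin.≟ u
  ... | yes refl = loopless G v (proj₁ (isEdgeIn⁻ G M q))
  ... | no  v≢u  = contradiction refl (proj₁ (proj₂ (disjoint p q (v≢u ∘ cong proj₁))))

  sumE-endpoints : ∀ (f : Fin n → ℚ) →
    sumE G M (λ i j → f i + f j) ≡ ∑[ v < n ] (if does (covered? G M v) then f v else 0ℚ)
  sumE-endpoints f = begin
    sumE G M (λ i j → f i + f j)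
      ≡⟨ sumE≡sum² G M _ ⟩
    ∑[ i < n ] ∑[ j < n ] summandE G M (λ i j → f i + f j) i j
      ≡⟨ sum-cong-≗ (λ i → trans (sum-cong-≗ (λ j → if-distrib-+ (isEdgeIn G M i j) (f i) (f j))) (∑-distrib-+ (tail i) (head i))) ⟩
    ∑[ i < n ] (∑[ j < n ] tail i j + ∑[ j < n ] head i j)
      ≡⟨ ∑-distrib-+ (λ i → ∑[ j < n ] tail i j) (λ i → ∑[ j < n ] head i j) ⟩
    ∑[ i < n ] ∑[ j < n ] tail i j + ∑[ i < n ] ∑[ j < n ] head i j
      ≡⟨ cong₂ _+_ (sum-cong-≗ λ v → sum-if-unique (isEdgeIn G M v) (f v) λ _ _ → matched-unique-out)
                   (trans (∑-comm head) (sum-cong-≗ λ v → sum-if-unique (λ u → isEdgeIn G M u v) (f v) λ _ _ → matched-unique-in)) ⟩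
    ∑[ v < n ] fOut v + ∑[ v < n ] fIn v
      ≡⟨ ∑-distrib-+ fOut fIn ⟨
    ∑[ v < n ] (fOut v + fIn v)
      ≡⟨ sum-cong-≗ out-or-in ⟩
    ∑[ v < n ] (if does (covered? G M v) then f v else 0ℚ)
      ∎
    where
    open ≡-Reasoning
    tail head : Fin n → Fin n → ℚ
    tail i j = if isEdgeIn G M i j then f i else 0ℚ
    head i j = if isEdgeIn G M i j then f j else 0ℚ
    out? : ∀ v → Dec (∃ λ w → T (isEdgeIn G M v w))
    out? v = Fin.any? (λ w → T? (isEdgeIn G M v w))
    in? : ∀ v → Dec (∃ λ u → T (isEdgeIn G M u v))
    in? v = Fin.any? (λ u → T? (isEdgeIn G M u v))
    fOut fIn : Fin n → ℚ
    fOut v = if does (out? v) then f v else 0ℚ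
    fIn  v = if does (in? v) then f v else 0ℚ
    out-or-in : ∀ v → fOut v + fIn v ≡ (if does (covered? G M v) then f v else 0ℚ)
    out-or-in v with out? v | in? v
    ... | yes (_ , p) | yes (_ , q) = ⊥-elim (matched-not-out-and-in p q)
    ... | yes _       | no _        = +-identityʳ (f v)
    ... | no _        | yes _       = +-identityˡ (f v)
    ... | no _        | no _        = refl

insertEdge : ∀ {n} → (Fin n → Fin n → Bool) → Fin n → Fin n → Fin n → Fin n → Bool
insertEdge M i j k l = (does (k Fin.≟ i) ∧ does (l Fin.≟ j)) ∨ M k l

module _ {n} (M : Fin n → Fin n → Bool) (i j : Fin n) where

  insertEdge⁻ : ∀ {k l} → T (insertEdge M i j k l) → (k ≡ i × l ≡ j) ⊎ T (M k l)
  insertEdge⁻ {k} {l} t with k Fin.≟ i | l Fin.≟ j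
  ... | yes k≡i | yes l≡j = inj₁ (k≡i , l≡j)
  ... | yes _   | no _    = inj₂ t
  ... | no _    | _       = inj₂ t

  insertEdge-new : T (insertEdge M i j i j)
  insertEdge-new with i Fin.≟ i | j Fin.≟ j
  ... | yes _ | yes _ = tt
  ... | no i≢i | _    = contradiction refl i≢i
  ... | yes _ | no j≢j = contradiction refl j≢j

  insertEdge-old : ∀ {k l} → T (M k l) → T (insertEdge M i j k l)
  insertEdge-old = Equivalence.from T-∨ ∘ inj₂

Maximal : ∀ {n} → Graph n → (Fin n → Fin n → Bool) → Set
Maximal G M = ∀ i j → Edge G i j → Covered G M i ⊎ Covered G M j

Extendable : ∀ {n} → Graph n → (Fin n → Fin n → Bool) → Fin n → Fin n → Set
Extendable G M i j = Edge G i j × ¬ Covered G M i × ¬ Covered G M j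

extendable? : ∀ {n} (G : Graph n) M i j → Dec (Extendable G M i j)
extendable? G M i j = T? (isEdge G i j) ×-dec ¬? (covered? G M i) ×-dec ¬? (covered? G M j)

module _ {n} (G : Graph n) (M : Fin n → Fin n → Bool) (i j : Fin n) where

  covered-insertEdge : ∀ {v} → Covered G M v → Covered G (insertEdge M i j) v
  covered-insertEdge = Sum.map (Product.map₂ extend) (Product.map₂ extend)
    where
    extend : ∀ {k l} → T (isEdgeIn G M k l) → T (isEdgeIn G (insertEdge M i j) k l)
    extend p = let (e , m) = isEdgeIn⁻ G M p in isEdgeIn⁺ G (insertEdge M i j) e (insertEdge-old M i j m)

  insertEdge-covers : Edge G i j → Covered G (insertEdge M i j) i
  insertEdge-covers e = inj₁ (j , isEdgeIn⁺ G (insertEdge M i j) e (insertEdge-new M i j))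

  insertEdge-matching : IsMatching G M → Extendable G M i j → IsMatching G (insertEdge M i j)
  insertEdge-matching (edges , disjoint) (e , ¬ci , ¬cj) = edges′ , disjoint′
    where
    avoids : ∀ {x k l} → ¬ Covered G M x → T (M k l) → (x ≢ k) × (x ≢ l)
    avoids ¬cx m = (λ { refl → ¬cx (inj₁ (_ , matched m)) }) , (λ { refl → ¬cx (inj₂ (_ , matched m)) })
      where matched = λ {k l} (m : T (M k l)) → isEdgeIn⁺ G M (edges k l m) m
    edges′ : ∀ k l → T (insertEdge M i j k l) → Edge G k l
    edges′ k l t with insertEdge⁻ M i j t
    ... | inj₁ (refl , refl) = e
    ... | inj₂ m             = edges k l m
    disjoint′ : ∀ a b k l → T (insertEdge M i j a b) → T (insertEdge M i j k l) → (a , b) ≢ (k , l) →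
      (a ≢ k) × (a ≢ l) × (b ≢ k) × (b ≢ l)
    disjoint′ a b k l t u ne with insertEdge⁻ M i j t | insertEdge⁻ M i j u
    ... | inj₁ (refl , refl) | inj₁ (refl , refl) = contradiction refl ne
    ... | inj₂ m             | inj₂ m′            = disjoint a b k l m m′ ne
    ... | inj₁ (refl , refl) | inj₂ m′            =
      let (i≢k , i≢l) = avoids ¬ci m′ ; (j≢k , j≢l) = avoids ¬cj m′ in i≢k , i≢l , j≢k , j≢l
    ... | inj₂ m             | inj₁ (refl , refl) =
      let (i≢a , i≢b) = avoids ¬ci m ; (j≢a , j≢b) = avoids ¬cj m in i≢a ∘ sym , j≢a ∘ sym , i≢b ∘ sym , j≢b ∘ sym

greedyStep : ∀ {n} → Graph n → (Fin n → Fin n → Bool) → Fin n × Fin n → Fin n → Fin n → Bool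
greedyStep G M (i , j) with extendable? G M i j
... | yes _ = insertEdge M i j
... | no _  = M

module _ {n} (G : Graph n) where

  greedyStep-matching : ∀ {M} e → IsMatching G M → IsMatching G (greedyStep G M e)
  greedyStep-matching {M} (i , j) isM with extendable? G M i j
  ... | yes ext = insertEdge-matching G M i j isM ext
  ... | no _    = isM

  greedyStep-covered : ∀ {M v} e → Covered G M v → Covered G (greedyStep G M e) v
  greedyStep-covered {M} (i , j) c with extendable? G M i j
  ... | yes _ = covered-insertEdge G M i j c
  ... | no _  = c

  greedyStep-covers : ∀ {M i j} → Edge G i j → Covered G (greedyStep G M (i , j)) i ⊎ Covered G (greedyStep G M (i , j)) j
  greedyStep-covers {M} {i} {j} e with extendable? G M i j
  ... | yes _ = inj₁ (insertEdge-covers G M i j e)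
  ... | no ¬ext with covered? G M i | covered? G M j
  ...   | yes ci | _      = inj₁ ci
  ...   | no _   | yes cj = inj₂ cj
  ...   | no ¬ci | no ¬cj = contradiction (e , ¬ci , ¬cj) ¬ext

  greedy : (Fin n → Fin n → Bool) → List (Fin n × Fin n) → Fin n → Fin n → Bool
  greedy = foldl (greedyStep G)

  greedy-matching : ∀ {M} es → IsMatching G M → IsMatching G (greedy M es)
  greedy-matching []       isM = isM
  greedy-matching (e ∷ es) isM = greedy-matching es (greedyStep-matching e isM)

  greedy-covered : ∀ {M v} es → Covered G M v → Covered G (greedy M es) v
  greedy-covered []       c = c
  greedy-covered (e ∷ es) c = greedy-covered es (greedyStep-covered e c)

  greedy-covers : ∀ {M i j es} → (i , j) ∈ es → Edge G i j → Covered G (greedy M es) i ⊎ Covered G (greedy M es) j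
  greedy-covers {es = _ ∷ es} (here refl) e = Sum.map (greedy-covered es) (greedy-covered es) (greedyStep-covers e)
  greedy-covers {es = _ ∷ es} (there p)   e = greedy-covers p e

∈-pairs : ∀ {n} (i j : Fin n) → (i , j) ∈ pairs n
∈-pairs {n} i j = ∈-concatMap⁺ (λ k → map (k ,_) (allFin n)) (Any.map (λ { refl → ∈-map⁺ (i ,_) (∈-allFin j) }) (∈-allFin i))

maximal-matching : ∀ {n} (G : Graph n) → ∃ λ M → IsMatching G M × Maximal G M
maximal-matching {n} G = greedy G empty (pairs n) , greedy-matching G (pairs n) ((λ _ _ ()) , λ _ _ _ _ ()) ,
  λ i j → greedy-covers G (∈-pairs i j)
  where
  empty : Fin n → Fin n → Bool
  empty _ _ = false

-- Rounding a fractional vertex cover to a half-integral one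

half-homo-sum : ∀ {n} (f : Fin n → ℕ) → half (ℕΣ.sum f) ≡ ∑[ v < n ] half (f v)
half-homo-sum {zero}  f = refl
half-homo-sum {suc n} f = trans (half-homo-+ (f zero) (ℕΣ.sum (f ∘ suc))) (cong (_+_ (half (f zero))) (half-homo-sum (f ∘ suc)))

common-denominator : ∀ {n} (y : Fin n → ℚ) → (∀ v → 0ℚ ≤ y v) →
  ∃ λ K → ∃ λ (Y : Fin n → ℕ) → ∀ v → y v * fromℕ (suc K) ≡ fromℕ (Y v)
common-denominator {zero}  y _   = 0 , (λ ()) , λ ()
common-denominator {suc n} y y≥0 = ℕ.pred (suc K ℕ.* d) , Y′ , scale
  where
  open ≡-Reasoning
  tail : ∃ λ K → ∃ λ (Y : Fin n → ℕ) → ∀ v → y (suc v) * fromℕ (suc K) ≡ fromℕ (Y v)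
  tail = common-denominator (y ∘ suc) (y≥0 ∘ suc)
  K : ℕ
  K = proj₁ tail
  Y : Fin n → ℕ
  Y = proj₁ (proj₂ tail)
  numerator : ∃ λ a → ↥ y zero ≡ + a
  numerator = numerator-nonNeg (y zero) (y≥0 zero)
  d : ℕ
  d = ↧ₙ y zero
  Y′ : Fin (suc n) → ℕ
  Y′ zero    = proj₁ numerator ℕ.* suc K
  Y′ (suc v) = Y v ℕ.* d
  scale : ∀ v → y v * fromℕ (suc K ℕ.* d) ≡ fromℕ (Y′ v)
  scale zero = begin
    y zero * fromℕ (suc K ℕ.* d)             ≡⟨ cong (y zero *_) (trans (fromℕ-homo-* (suc K) d) (*-comm (fromℕ (suc K)) (fromℕ d))) ⟩
    y zero * (fromℕ d * fromℕ (suc K))       ≡⟨ *-assoc (y zero) (fromℕ d) (fromℕ (suc K)) ⟨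
    y zero * fromℕ d * fromℕ (suc K)         ≡⟨ cong (_* fromℕ (suc K)) (*-denominator (y zero) (proj₂ numerator)) ⟩
    fromℕ (proj₁ numerator) * fromℕ (suc K)  ≡⟨ fromℕ-homo-* (proj₁ numerator) (suc K) ⟨
    fromℕ (proj₁ numerator ℕ.* suc K)        ∎
  scale (suc v) = begin
    y (suc v) * fromℕ (suc K ℕ.* d)          ≡⟨ cong (y (suc v) *_) (fromℕ-homo-* (suc K) d) ⟩
    y (suc v) * (fromℕ (suc K) * fromℕ d)    ≡⟨ *-assoc (y (suc v)) (fromℕ (suc K)) (fromℕ d) ⟨
    y (suc v) * fromℕ (suc K) * fromℕ d      ≡⟨ cong (_* fromℕ d) (proj₂ (proj₂ tail) v) ⟩
    fromℕ (Y v) * fromℕ d                    ≡⟨ fromℕ-homo-* (Y v) d ⟨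
    fromℕ (Y v ℕ.* d)                        ∎

HalfRounding : ∀ {n} → (Fin n → ℚ) → (Fin n → ℕ) → Set
HalfRounding {n} y Z = (∀ v → Z v ℕ.≤ 2)
                     × (∀ u v → 1ℚ ≤ y u + y v → 2 ℕ.≤ Z u ℕ.+ Z v)
                     × (∀ v → y v ≡ 0ℚ → Z v ≡ 0)
                     × ∑[ v < n ] half (Z v) ≤ ∑[ v < n ] y v

module _ {n} (y : Fin n → ℚ) (K′ : ℕ) (A : Fin n → ℕ) (scaled : ∀ v → y v * fromℕ (suc K′) ≡ half (A v)) where

  private
    K : ℕ
    K = suc K′
    instance
      K-positive : Positive (fromℕ K)
      K-positive = fromℕ-suc-positive K′
      K-nonNegative : NonNegative (fromℕ K)
      K-nonNegative = pos⇒nonNeg (fromℕ K)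

  threshold-rounding : ∀ {m} → m ℕ.< K → K ℕ.* ℕΣ.sum (λ v → roundAt K m (A v)) ℕ.≤ ℕΣ.sum A →
    HalfRounding y (λ v → roundAt K m (A v))
  threshold-rounding {m} m<K average = (λ v → roundAt-≤2 K m (A v)) , cover , zero-fixed , sum-≤
    where
    Z : Fin n → ℕ
    Z v = roundAt K m (A v)

    cover : ∀ u v → 1ℚ ≤ y u + y v → 2 ℕ.≤ Z u ℕ.+ Z v
    cover u v 1≤yu+yv = roundAt-cover {K} {m} {A u} {A v} m<K (half-cancel-≤ {K ℕ.+ K} {A u ℕ.+ A v} (begin
      half (K ℕ.+ K)                ≡⟨ cong (λ k → half (K ℕ.+ k)) (ℕ.+-identityʳ K) ⟨
      half (2 ℕ.* K)                ≡⟨ fromℕ≡half-double K ⟨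
      fromℕ K                       ≡⟨ *-identityˡ (fromℕ K) ⟨
      1ℚ * fromℕ K                  ≤⟨ *-monoʳ-≤-nonNeg (fromℕ K) 1≤yu+yv ⟩
      (y u + y v) * fromℕ K         ≡⟨ *-distribʳ-+ (fromℕ K) (y u) (y v) ⟩
      y u * fromℕ K + y v * fromℕ K ≡⟨ cong₂ _+_ (scaled u) (scaled v) ⟩
      half (A u) + half (A v)       ≡⟨ half-homo-+ (A u) (A v) ⟨
      half (A u ℕ.+ A v)            ∎))
      where open ≤-Reasoning

    zero-fixed : ∀ v → y v ≡ 0ℚ → Z v ≡ 0
    zero-fixed v yv≡0 = trans (cong (roundAt K m) (ℕ.n≤0⇒n≡0 (half-cancel-≤ {A v} {0} (≤-reflexive (begin
      half (A v)          ≡⟨ scaled v ⟨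
      y v * fromℕ K       ≡⟨ cong (_* fromℕ K) yv≡0 ⟩
      0ℚ * fromℕ K        ≡⟨ *-zeroˡ (fromℕ K) ⟩
      half 0              ∎))))) (roundAt-zero m<K)
      where open ≡-Reasoning

    sum-≤ : ∑[ v < n ] half (Z v) ≤ ∑[ v < n ] y v
    sum-≤ = *-cancelʳ-≤-pos (fromℕ K) (begin
      ∑[ v < n ] half (Z v) * fromℕ K        ≡⟨ cong (_* fromℕ K) (half-homo-sum Z) ⟨
      half (ℕΣ.sum Z) * fromℕ K              ≡⟨ half-*-fromℕ (ℕΣ.sum Z) K ⟩
      half (ℕΣ.sum Z ℕ.* K)                  ≤⟨ half-mono-≤ (ℕ.≤-trans (ℕ.≤-reflexive (ℕ.*-comm (ℕΣ.sum Z) K)) average) ⟩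
      half (ℕΣ.sum A)                        ≡⟨ half-homo-sum A ⟩
      ∑[ v < n ] half (A v)                  ≡⟨ sum-cong-≗ scaled ⟨
      ∑[ v < n ] (y v * fromℕ K)             ≡⟨ *-distribʳ-sum (fromℕ K) y ⟨
      ∑[ v < n ] y v * fromℕ K               ∎)
      where open ≤-Reasoning

half-integral-rounding : ∀ {n} (y : Fin n → ℚ) → (∀ v → 0ℚ ≤ y v) → ∃ (HalfRounding y)
half-integral-rounding {n} y y≥0 = _ , threshold-rounding y K′ A scaled (proj₁ (proj₂ threshold)) (proj₂ (proj₂ threshold))
  where
  denominator : ∃ λ K′ → ∃ λ (Y : Fin n → ℕ) → ∀ v → y v * fromℕ (suc K′) ≡ fromℕ (Y v)
  denominator = common-denominator y y≥0
  K′ : ℕ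
  K′ = proj₁ denominator
  A : Fin n → ℕ
  A v = 2 ℕ.* proj₁ (proj₂ denominator) v
  scaled : ∀ v → y v * fromℕ (suc K′) ≡ half (A v)
  scaled v = trans (proj₂ (proj₂ denominator) v) (fromℕ≡half-double (proj₁ (proj₂ denominator) v))
  threshold : ∃ λ m → m ℕ.< suc K′ × suc K′ ℕ.* ℕΣ.sum (λ v → roundAt (suc K′) m (A v)) ℕ.≤ ℕΣ.sum A
  threshold = ∃-threshold K′ A

-- Feasible solutions and their half-integral codes

matching? : ∀ {n} (G : Graph n) M → Dec (IsMatching G M)
matching? G M =
  (Fin.all? λ i → Fin.all? λ j → T? (M i j) →-dec T? (isEdge G i j)) ×-dec
  (Fin.all? λ i → Fin.all? λ j → Fin.all? λ k → Fin.all? λ l → T? (M i j) →-dec T? (M k l) →-dec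
     ¬? (≡-dec Fin._≟_ Fin._≟_ (i , j) (k , l)) →-dec
     (¬? (i Fin.≟ k) ×-dec ¬? (i Fin.≟ l) ×-dec ¬? (j Fin.≟ k) ×-dec ¬? (j Fin.≟ l)))

feasible? : ∀ {n} (G : Graph n) M y c → Dec (MFASPFeasible G M y c)
feasible? G M y c =
  (Fin.all? λ i → Fin.all? λ j → T? (isEdge G i j) →-dec 0ℚ ≤? c i j) ×-dec
  matching? G M ×-dec
  ((Fin.all? λ v → 0ℚ ≤? y v) ×-dec (Fin.all? λ i → Fin.all? λ j → T? (isEdge G i j) →-dec 1ℚ + c i j ≤? y i + y j)) ×-dec
  sumE G M (λ i j → 1ℚ + c i j) ≟ sumV y

module _ {n} (G : Graph n) {M M′ : Fin n → Fin n → Bool} {y y′ : Fin n → ℚ} {c c′ : Fin n → Fin n → ℚ}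
         (M≗M′ : ∀ i j → M i j ≡ M′ i j) (y≗y′ : ∀ v → y v ≡ y′ v) (c≗c′ : ∀ i j → c i j ≡ c′ i j) where

  feasible-resp : MFASPFeasible G M y c → MFASPFeasible G M′ y′ c′
  feasible-resp (c≥0 , (edges , disjoint) , (y≥0 , cover) , balance) =
    (λ i j e → subst (0ℚ ≤_) (c≗c′ i j) (c≥0 i j e)) ,
    ((λ i j m → edges i j (toM m)) , λ i j k l m m′ → disjoint i j k l (toM m) (toM m′)) ,
    ((λ v → subst (0ℚ ≤_) (y≗y′ v) (y≥0 v)) ,
     λ i j e → subst₂ _≤_ (cong (_+_ 1ℚ) (c≗c′ i j)) (cong₂ _+_ (y≗y′ i) (y≗y′ j)) (cover i j e)) ,
    (begin
      sumE G M′ (λ i j → 1ℚ + c′ i j) ≡⟨ sumE-cong G (λ i j → cong₂ (λ b x → if isEdge G i j ∧ b then 1ℚ + x else 0ℚ) (M≗M′ i j) (c≗c′ i j)) ⟨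
      sumE G M (λ i j → 1ℚ + c i j)   ≡⟨ balance ⟩
      sumV y                          ≡⟨ trans (sumV≡sum y) (trans (sum-cong-≗ y≗y′) (sym (sumV≡sum y′))) ⟩
      sumV y′                         ∎)
    where
    open ≡-Reasoning
    toM : ∀ {i j} → T (M′ i j) → T (M i j)
    toM {i} {j} = subst T (sym (M≗M′ i j))

if-does-≡ : ∀ {A : Set} (d : Dec A) {x} → (¬ A → x ≡ 0ℚ) → (if does d then x else 0ℚ) ≡ x
if-does-≡ (yes _) _      = refl
if-does-≡ (no ¬a) vanish = sym (vanish ¬a)

if-≤ : ∀ b {x} → 0ℚ ≤ x → (if b then x else 0ℚ) ≤ x
if-≤ true  _   = ≤-refl
if-≤ false x≥0 = x≥0

-- c = y_i + y_j - 1 on the matching; the truncated ∸ is exact on edges, where Z i + Z j ≥ 2.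
excess : ∀ {n} → (Fin n → Fin n → Bool) → (Fin n → ℕ) → Fin n → Fin n → ℚ
excess M Z i j = if M i j then half (Z i ℕ.+ Z j ℕ.∸ 2) else 0ℚ

module _ {n} (G : Graph n) {M : Fin n → Fin n → Bool} (isM : IsMatching G M) where

  uncovered-vanish : ∀ {y c} → MFASPFeasible G M y c → ∀ v → ¬ Covered G M v → y v ≡ 0ℚ
  uncovered-vanish {y} {c} (_ , _ , (y≥0 , cover) , balance) v ¬cv =
    ≤-antisym (≤-trans (sum-squeeze (λ v → if-≤ _ (y≥0 v)) Σy≤Σyᶜ v) (≤-reflexive yᶜv≡0)) (y≥0 v)
    where
    yᶜ : Fin n → ℚ
    yᶜ v = if does (covered? G M v) then y v else 0ℚ
    yᶜv≡0 : yᶜ v ≡ 0ℚ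
    yᶜv≡0 = cong (if_then y v else 0ℚ) (dec-false (covered? G M v) ¬cv)
    Σy≤Σyᶜ : ∑[ v < n ] y v ≤ ∑[ v < n ] yᶜ v
    Σy≤Σyᶜ = begin
      ∑[ v < n ] y v                      ≡⟨ sumV≡sum y ⟨
      sumV y                              ≡⟨ balance ⟨
      sumE G M (λ i j → 1ℚ + c i j)       ≤⟨ sumE-mono-on G (λ i j p → cover i j (proj₁ (isEdgeIn⁻ G M p))) ⟩
      sumE G M (λ i j → y i + y j)        ≡⟨ sumE-endpoints G isM y ⟩
      ∑[ v < n ] yᶜ v                     ∎
      where open ≤-Reasoning

  module _ {Z : Fin n → ℕ} (Z-cover : ∀ i j → Edge G i j → 2 ℕ.≤ Z i ℕ.+ Z j) where

    tight : ∀ i j → Edge G i j → 1ℚ + half (Z i ℕ.+ Z j ℕ.∸ 2) ≡ half (Z i) + half (Z j)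
    tight i j e = trans (1+half[a∸2]≡half[a] (Z-cover i j e)) (half-homo-+ (Z i) (Z j))

    excess-tight : ∀ i j → Edge G i j → T (M i j) → 1ℚ + excess M Z i j ≡ half (Z i) + half (Z j)
    excess-tight i j e m with M i j
    ... | true  = tight i j e
    ... | false = contradiction m λ ()

    code-feasible : (∀ v → ¬ Covered G M v → Z v ≡ 0) → MFASPFeasible G M (half ∘ Z) (excess M Z)
    code-feasible Z-uncovered = excess≥0 , isM , (half-nonNeg ∘ Z , cover) , balance
      where
      excess≥0 : ∀ i j → Edge G i j → 0ℚ ≤ excess M Z i j
      excess≥0 i j _ with M i j
      ... | true  = half-nonNeg (Z i ℕ.+ Z j ℕ.∸ 2)
      ... | false = ≤-refl
      cover : ∀ i j → Edge G i j → 1ℚ + excess M Z i j ≤ half (Z i) + half (Z j)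
      cover i j e with M i j
      ... | true  = ≤-reflexive (tight i j e)
      ... | false = ≤-trans (≤-reflexive (+-identityʳ 1ℚ))
                            (≤-trans (half-mono-≤ (Z-cover i j e)) (≤-reflexive (half-homo-+ (Z i) (Z j))))
      balance : sumE G M (λ i j → 1ℚ + excess M Z i j) ≡ sumV (half ∘ Z)
      balance = begin
        sumE G M (λ i j → 1ℚ + excess M Z i j)                    ≡⟨ sumE-cong-on G (λ i j p → let (e , m) = isEdgeIn⁻ G M p in excess-tight i j e m) ⟩
        sumE G M (λ i j → half (Z i) + half (Z j))                ≡⟨ sumE-endpoints G isM (half ∘ Z) ⟩
        ∑[ v < n ] (if does (covered? G M v) then half (Z v) else 0ℚ) ≡⟨ sum-cong-≗ (λ v → if-does-≡ (covered? G M v) (cong half ∘ Z-uncovered v)) ⟩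
        ∑[ v < n ] half (Z v)                                     ≡⟨ sumV≡sum (half ∘ Z) ⟨
        sumV (half ∘ Z)                                           ∎
        where open ≡-Reasoning

Code : ℕ → Set
Code n = (Fin n → Fin n → Bool) × (Fin n → ℕ)

FeasibleCode : ∀ {n} → Graph n → Code n → Set
FeasibleCode G (M , Z) = MFASPFeasible G M (half ∘ Z) (excess M Z)

feasibleCode? : ∀ {n} (G : Graph n) x → Dec (FeasibleCode G x)
feasibleCode? G (M , Z) = feasible? G M (half ∘ Z) (excess M Z)

codeCost : ∀ {n} → Graph n → Code n → ℚ
codeCost G (M , Z) = cost G (excess M Z)

module _ {n} (G : Graph n) {M : Fin n → Fin n → Bool} {y : Fin n → ℚ} {c : Fin n → Fin n → ℚ}
         {Z : Fin n → ℕ} (rounding : HalfRounding y Z) where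

  rounding-feasible : MFASPFeasible G M y c → FeasibleCode G (M , Z)
  rounding-feasible feasible@(c≥0 , isM , (_ , cover) , _) =
    code-feasible G isM Z-cover λ v ¬cv → proj₁ (proj₂ (proj₂ rounding)) v (uncovered-vanish G isM feasible v ¬cv)
    where
    Z-cover : ∀ i j → Edge G i j → 2 ℕ.≤ Z i ℕ.+ Z j
    Z-cover i j e = proj₁ (proj₂ rounding) i j
      (≤-trans (≤-trans (≤-reflexive (sym (+-identityʳ 1ℚ))) (+-monoʳ-≤ 1ℚ (c≥0 i j e))) (cover i j e))

  rounding-cost-≤ : MFASPFeasible G M y c → codeCost G (M , Z) ≤ cost G c
  rounding-cost-≤ feasible@(c≥0 , _ , _ , balance) = begin
    cost G (excess M Z)      ≡⟨ cost≡sumE G M excess-off-M ⟩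
    sumE G M (excess M Z)    ≤⟨ +-cancelˡ-≤ (sumE G M one) (begin
      sumE G M one + sumE G M (excess M Z)    ≡⟨ sumE-+ G M one (excess M Z) ⟨
      sumE G M (λ i j → 1ℚ + excess M Z i j)  ≡⟨ proj₂ (proj₂ (proj₂ (rounding-feasible feasible))) ⟩
      sumV (half ∘ Z)                         ≡⟨ sumV≡sum (half ∘ Z) ⟩
      ∑[ v < n ] half (Z v)                   ≤⟨ proj₂ (proj₂ (proj₂ rounding)) ⟩
      ∑[ v < n ] y v                          ≡⟨ sumV≡sum y ⟨
      sumV y                                  ≡⟨ balance ⟨
      sumE G M (λ i j → 1ℚ + c i j)           ≡⟨ sumE-+ G M one c ⟩
      sumE G M one + sumE G M c               ∎) ⟩
    sumE G M c               ≤⟨ sumE≤cost G M c≥0 ⟩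
    cost G c                 ∎
    where
    open ≤-Reasoning
    one : Fin n → Fin n → ℚ
    one _ _ = 1ℚ
    excess-off-M : ∀ i j → ¬ T (M i j) → excess M Z i j ≡ 0ℚ
    excess-off-M i j ¬m with M i j
    ... | true  = contradiction _ ¬m
    ... | false = refl

feasible⇒cheaper-code : ∀ {n} (G : Graph n) {M y c} → MFASPFeasible G M y c →
  ∃ λ (Z : Fin n → ℕ) → (∀ v → Z v ℕ.≤ 2) × FeasibleCode G (M , Z) × codeCost G (M , Z) ≤ cost G c
feasible⇒cheaper-code G feasible@(_ , _ , (y≥0 , _) , _) =
  Product.map₂ (λ r → proj₁ r , rounding-feasible G r feasible , rounding-cost-≤ G r feasible) (half-integral-rounding _ y≥0)

functions : ∀ {A : Set} n → List A → List (Fin n → A)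
functions zero    xs = (λ ()) ∷ []
functions (suc n) xs = concatMap (λ a → map (a Vector.∷_) (functions n xs)) xs

functions⁺ : ∀ {A B : Set} {R : B → A → Set} n {xs} (f : Fin n → B) →
  (∀ i → Any (R (f i)) xs) → Any (λ g → ∀ i → R (f i) (g i)) (functions n xs)
functions⁺ zero    f _  = here λ ()
functions⁺ {R = R} (suc n) {xs} f f∈ = Any.concatMap⁺ (λ a → map (a Vector.∷_) (functions n xs))
  (Any.map (λ R₀ → Any.map⁺ (Any.map (λ Rₛ → λ { zero → R₀ ; (suc i) → Rₛ i }) tail)) (f∈ zero))
  where
  tail : Any (λ g → ∀ i → R (f (suc i)) (g i)) (functions n xs)
  tail = functions⁺ {R = R} n (f ∘ suc) (f∈ ∘ suc)

-- Codes are functions, and without function extensionality they are only listed up to this.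
_≈ᶜ_ : ∀ {n} → Code n → Code n → Set
(M , Z) ≈ᶜ (M′ , Z′) = (∀ i j → M i j ≡ M′ i j) × (∀ v → Z v ≡ Z′ v)

codes : ∀ n → List (Code n)
codes n = cartesianProduct (functions n (functions n (true ∷ false ∷ []))) (functions n (upTo 3))

codes⁺ : ∀ {n} M (Z : Fin n → ℕ) → (∀ v → Z v ℕ.≤ 2) → Any ((M , Z) ≈ᶜ_) (codes n)
codes⁺ {n} M Z Z≤2 = Any.cartesianProduct⁺
  (functions⁺ {R = λ h g → ∀ j → h j ≡ g j} n M λ i → functions⁺ {R = _≡_} n (M i) (bool∈ ∘ M i))
  (functions⁺ {R = _≡_} n Z λ v → ∈-upTo⁺ (s≤s (Z≤2 v)))
  where
  bool∈ : ∀ b → b ∈ true ∷ false ∷ []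
  bool∈ true  = here refl
  bool∈ false = there (here refl)

module _ {n} (G : Graph n) {x x′ : Code n} (x≈x′ : x ≈ᶜ x′) where

  private
    excess-cong : ∀ i j → excess (proj₁ x) (proj₂ x) i j ≡ excess (proj₁ x′) (proj₂ x′) i j
    excess-cong i j rewrite proj₁ x≈x′ i j | proj₂ x≈x′ i | proj₂ x≈x′ j = refl

  feasibleCode-resp : FeasibleCode G x → FeasibleCode G x′
  feasibleCode-resp = feasible-resp G (proj₁ x≈x′) (cong half ∘ proj₂ x≈x′) excess-cong

  codeCost-cong : codeCost G x ≡ codeCost G x′
  codeCost-cong = sumE-cong G λ i j → cong (λ c → if isEdge G i j ∧ true then c else 0ℚ) (excess-cong i j)

∃-feasibleCode : ∀ {n} (G : Graph n) → ∃ (FeasibleCode G)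
∃-feasibleCode G = from-maximal (maximal-matching G)
  where
  from-maximal : (∃ λ M → IsMatching G M × Maximal G M) → ∃ (FeasibleCode G)
  from-maximal (M , isM , maximal) =
    (M , Z) , code-feasible G isM cover λ v ¬cv → cong (if_then 2 else 0) (dec-false (covered? G M v) ¬cv)
    where
    Z : Fin _ → ℕ
    Z v = if does (covered? G M v) then 2 else 0
    two : ∀ {v} → Covered G M v → Z v ≡ 2
    two {v} cv = cong (if_then 2 else 0) (dec-true (covered? G M v) cv)
    cover : ∀ i j → Edge G i j → 2 ℕ.≤ Z i ℕ.+ Z j
    cover i j e with maximal i j e
    ... | inj₁ ci = ℕ.≤-trans (ℕ.≤-reflexive (sym (two ci))) (ℕ.m≤m+n (Z i) (Z j))
    ... | inj₂ cj = ℕ.≤-trans (ℕ.≤-reflexive (sym (two cj))) (ℕ.m≤n+m (Z j) (Z i))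

optimal-code : ∀ {n} (G : Graph n) → ∃ λ (x : Code n) → FeasibleCode G x ×
  (∀ M y c → MFASPFeasible G M y c → codeCost G x ≤ cost G c)
optimal-code {n} G = best , best-feasible , best-optimal
  where
  candidates : List (Code n)
  candidates = filter (feasibleCode? G) (codes n)
  start : Code n
  start = proj₁ (∃-feasibleCode G)
  best : Code n
  best = argmin (codeCost G) start candidates
  best-feasible : FeasibleCode G best
  best-feasible = argmin-all (codeCost G) (proj₂ (∃-feasibleCode G)) (all-filter (feasibleCode? G) (codes n))
  best-optimal : ∀ M y c → MFASPFeasible G M y c → codeCost G best ≤ cost G c
  best-optimal M y c feasible = bound (feasible⇒cheaper-code G feasible)
    where
    bound : (∃ λ Z → (∀ v → Z v ℕ.≤ 2) × FeasibleCode G (M , Z) × codeCost G (M , Z) ≤ cost G c) →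
            codeCost G best ≤ cost G c
    bound (Z , Z≤2 , feasibleZ , cost≤) = ≤-trans (f[argmin]≤v⁺ start candidates (inj₂ candidate)) cost≤
      where
      listed : Any ((M , Z) ≈ᶜ_) (codes n)
      listed = codes⁺ M Z Z≤2
      candidate : Any (λ x → codeCost G x ≤ codeCost G (M , Z)) candidates
      candidate = [ Any.map (λ ≈x → ≤-reflexive (sym (codeCost-cong G ≈x))) ,
                    (λ infeasible → contradiction (feasibleCode-resp G (Any.lookup-result listed) feasibleZ) infeasible) ]′
                  (Any.filter⁺ (feasibleCode? G) listed)

excess-halfIntegral : ∀ {n} (M : Fin n → Fin n → Bool) Z i j → HalfIntegral (excess M Z i j)
excess-halfIntegral M Z i j with M i j
... | true  = + (Z i ℕ.+ Z j ℕ.∸ 2) , refl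
... | false = + 0 , refl

lemma3 : (n : ℕ) (G : Graph n) →
    ∃ λ M → ∃ λ y → ∃ λ c →
      MFASPOptimal G M y c ×
      (∀ i j → Edge G i j → HalfIntegral (c i j)) ×
      (∀ v → HalfIntegral (y v))
lemma3 n G =
  let ((M , Z) , feasible , optimal) = optimal-code G
  in M , half ∘ Z , excess M Z , (feasible , optimal) , (λ i j _ → excess-halfIntegral M Z i j) , λ v → + Z v , refl
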